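{- For any formulas $\phi$ and $\psi$ in the language of $\mathbf{PT}^+$: if $\psi\models\phi$ then $\psi\vdash\phi$ in the natural deduction system of $\mathbf{PT}^+$. In particular, if $\models\phi$ then $\vdash\phi$.
   Context: Formulas of $\mathbf{PT}^+$: $\phi::=p_i\mid\neg p_i\mid\bot\mid\mathrm{NE}\mid\phi\wedge\phi\mid\phi\otimes\phi\mid\phi\vee\phi$ ($i\in\mathbb N$). A valuation is $s:\mathbb N\to\{0,1\}$, a team a set of valuations. Semantics: $X\models p_i$ iff $s(i)=1$ for all $s\in X$; $X\models\neg p_i$ iff $s(i)=0$ for all $s\in X$; $X\models\bot$ iff $X=\emptyset$; $X\models\mathrm{NE}$ iff $X\ne\emptyset$; $\wedge$ as usual; $X\models\phi\otimes\psi$ iff $X=Y\cup Z$ for some $Y,Z\subseteq X$ with $Y\models\phi$, $Z\models\psi$; $X\models\phi\vee\psi$ iff $X\models\phi$ or $X\models\psi$. $\psi\models\phi$: every team satisfying $\psi$ satisfies $\phi$; $\models\phi$: every team satisfies $\phi$. Classical formulas: built from $p_i,\neg p_i,\bot$ by $\wedge,\otimes$. $p_i^1=p_i$, $p_i^0=\neg p_i$; empty $\otimes$-disjunction is $\bot$, empty $\vee$-disjunction is $\bot\wedge\mathrm{NE}$; for a team $X$ on finite $\{i_1,\dots,i_n\}$, $\Theta^*_X=\bigotimes_{s\in X}(p_{i_1}^{s(i_1)}\wedge\dots\wedge p_{i_n}^{s(i_n)}\wedge\mathrm{NE})$. Natural deduction system of $\mathbf{PT}^+$ ($\Gamma\vdash\phi$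 iff some derivation of $\phi$ has undischarged assumptions in $\Gamma$; metavariables range over all formulas, axioms are the specific formulas shown, no substitution rule). Axioms: $p_i\otimes\neg p_i$ (each $i$); $\bot\vee\mathrm{NE}$. Rules: standard $\wedge$-introduction/elimination; $\vee$-introduction (from $\phi$ infer $\phi\vee\psi$ and $\psi\vee\phi$) and $\vee$-elimination (from $\phi\vee\psi$, a derivation of $\chi$ from $\phi$ and one from $\psi$, infer $\chi$, discharging $\phi,\psi$); from $\phi$ infer $\phi\otimes\psi$ provided $\psi$ does not contain $\mathrm{NE}$; from $\phi$ infer $\phi\otimes\phi$; from $\phi\otimes\psi$, a derivation of $\alpha$ from $\phi$ and one of $\alpha$ from $\psi$, infer $\alpha$ (discharging $\phi,\psi$), provided $\alpha$ is classical and the other undischarged assumptions of both subderivations are classical; from $\phi\otimes\psi$ and a derivation of $\chi$ from $\psi$ (discharged) infer $\phi\otimes\chi$, provided the other undischarged assumptions of that subderivation are classical; from $\phi\otimes\psi$ infer $\psi\otimes\phi$; from $\phi\otimes(\psi\otimes\chi)$ infer $(\phi\otimes\psi)\otimes\chi$; from $p_i\wedge\neg p_i$ infer $\bot$; from $\phi\otimes\bot$ infer $\phi$; from $\bot\wedge\mathrm{NE}$ infer any $\phi$; from $\phi\otimes(\bot\wedge\mathrm{NE})$ infer $\bot\wedge\mathrm{NE}$; from $\Theta^*_X\wedge\Theta^*_Y$ infer $\bot\wedge\mathrm{NE}$ whenever $X,Y$ are distinct teams on the same finite index set; from $\phi\otimes(\psi\vee\chi)$ infer $(\phi\otimes\psi)\vee(\phi\otimes\chi)$;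 from $\mathrm{NE}\wedge\bigotimes_{i\in I}\phi_i$ ($I$ finite) infer $\bigvee_{\emptyset\ne J\subseteq I}\bigotimes_{i\in J}(\mathrm{NE}\wedge\phi_i)$. -}

module Defs where

open import Data.Nat using (ℕ)
open import Data.Bool using (Bool; true; false)
open import Data.List using (List; []; _∷_; map; _++_)
open import Data.List.Membership.Propositional using (_∈_)
open import Data.List.Relation.Unary.All using (All)
open import Data.List.Relation.Unary.Unique.Propositional using (Unique)
open import Data.Vec using (Vec; []; _∷_)
open import Data.Product using (Σ; ∃; _×_; _,_)
open import Data.Sum using (_⊎_)
open import Data.Empty using (⊥)
open import Relation.Nullary using (¬_)
open import Relation.Binary.PropositionalEquality using (_≡_)
open import Function.Bundles using (_⇔_)
open import Level using (Lift)

infixr 6 _∧ᶠ_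
infixr 5 _⊗_
infixr 4 _∨ᶠ_

data Form : Set where
  var  : ℕ → Form
  nvar : ℕ → Form
  ⊥ᶠ   : Form
  NE   : Form
  _∧ᶠ_ : Form → Form → Form
  _⊗_  : Form → Form → Form
  _∨ᶠ_ : Form → Form → Form

data Classical : Form → Set where
  c-var  : ∀ i → Classical (var i)
  c-nvar : ∀ i → Classical (nvar i)
  c-⊥    : Classical ⊥ᶠ
  c-∧    : ∀ {φ ψ} → Classical φ → Classical ψ → Classical (φ ∧ᶠ ψ)
  c-⊗    : ∀ {φ ψ} → Classical φ → Classical ψ → Classical (φ ⊗ ψ)

data NoNE : Form → Set where
  n-var  : ∀ i → NoNE (var i)
  n-nvar : ∀ i → NoNE (nvar i)
  n-⊥    : NoNE ⊥ᶠ
  n-∧    : ∀ {φ ψ} → NoNE φ → NoNE ψ → NoNE (φ ∧ᶠ ψ)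
  n-⊗    : ∀ {φ ψ} → NoNE φ → NoNE ψ → NoNE (φ ⊗ ψ)
  n-∨    : ∀ {φ ψ} → NoNE φ → NoNE ψ → NoNE (φ ∨ᶠ ψ)

lit : ℕ → Bool → Form
lit i true  = var i
lit i false = nvar i

⨂ : List Form → Form
⨂ []           = ⊥ᶠ
⨂ (φ ∷ [])     = φ
⨂ (φ ∷ ψ ∷ φs) = φ ⊗ ⨂ (ψ ∷ φs)

⋁ : List Form → Form
⋁ []           = ⊥ᶠ ∧ᶠ NE
⋁ (φ ∷ [])     = φ
⋁ (φ ∷ ψ ∷ φs) = φ ∨ᶠ ⋁ (ψ ∷ φs)

rowFormula : ∀ {n} → Vec ℕ n → Vec Bool n → Form
rowFormula []       []       = NE
rowFormula (i ∷ is) (b ∷ bs) = lit i b ∧ᶠ rowFormula is bs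

-- Θ*_X for a team X on index set {i1,…,in}, X given by a listing of its
-- (restricted) valuations
Θ* : ∀ {n} → Vec ℕ n → List (Vec Bool n) → Form
Θ* is X = ⨂ (map (rowFormula is) X)

sublists : ∀ {A : Set} → List A → List (List A)
sublists []       = [] ∷ []
sublists (x ∷ xs) = let r = sublists xs in r ++ map (x ∷_) r

nonemptySublists : ∀ {A : Set} → List A → List (List A)
nonemptySublists []       = []
nonemptySublists (x ∷ xs) =
  nonemptySublists xs ++ map (x ∷_) (sublists xs)

_⊆ᶜ_ : List Form → List Form → Set
Γ ⊆ᶜ Δ = ∀ {φ} → φ ∈ Γ → φ ∈ Δ

infix 2 _⊢_

data _⊢_ : List Form → Form → Set where
  assum  : ∀ {Γ φ} → φ ∈ Γ → Γ ⊢ φ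
  weaken : ∀ {Γ Δ φ} → Γ ⊆ᶜ Δ → Γ ⊢ φ → Δ ⊢ φ
  ax-em  : ∀ {Γ} i → Γ ⊢ var i ⊗ nvar i
  ax-NE  : ∀ {Γ} → Γ ⊢ ⊥ᶠ ∨ᶠ NE
  ∧I     : ∀ {Γ φ ψ} → Γ ⊢ φ → Γ ⊢ ψ → Γ ⊢ φ ∧ᶠ ψ
  ∧E₁    : ∀ {Γ φ ψ} → Γ ⊢ φ ∧ᶠ ψ → Γ ⊢ φ
  ∧E₂    : ∀ {Γ φ ψ} → Γ ⊢ φ ∧ᶠ ψ → Γ ⊢ ψ
  ∨I₁    : ∀ {Γ φ ψ} → Γ ⊢ φ → Γ ⊢ φ ∨ᶠ ψ
  ∨I₂    : ∀ {Γ φ ψ} → Γ ⊢ ψ → Γ ⊢ φ ∨ᶠ ψ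
  ∨E     : ∀ {Γ φ ψ χ} → Γ ⊢ φ ∨ᶠ ψ → (φ ∷ Γ) ⊢ χ → (ψ ∷ Γ) ⊢ χ → Γ ⊢ χ
  ⊗I     : ∀ {Γ φ ψ} → NoNE ψ → Γ ⊢ φ → Γ ⊢ φ ⊗ ψ
  ⊗dup   : ∀ {Γ φ} → Γ ⊢ φ → Γ ⊢ φ ⊗ φ
  ⊗E     : ∀ {Γ Δ φ ψ α} → Classical α → All Classical Δ →
           Γ ⊢ φ ⊗ ψ → (φ ∷ Δ) ⊢ α → (ψ ∷ Δ) ⊢ α → (Γ ++ Δ) ⊢ α
  ⊗Sub   : ∀ {Γ Δ φ ψ χ} → All Classical Δ →
           Γ ⊢ φ ⊗ ψ → (ψ ∷ Δ) ⊢ χ → (Γ ++ Δ) ⊢ φ ⊗ χ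
  ⊗Com   : ∀ {Γ φ ψ} → Γ ⊢ φ ⊗ ψ → Γ ⊢ ψ ⊗ φ
  ⊗Ass   : ∀ {Γ φ ψ χ} → Γ ⊢ φ ⊗ (ψ ⊗ χ) → Γ ⊢ (φ ⊗ ψ) ⊗ χ
  contr  : ∀ {Γ} i → Γ ⊢ var i ∧ᶠ nvar i → Γ ⊢ ⊥ᶠ
  ⊗⊥E    : ∀ {Γ φ} → Γ ⊢ φ ⊗ ⊥ᶠ → Γ ⊢ φ
  exfalso : ∀ {Γ φ} → Γ ⊢ ⊥ᶠ ∧ᶠ NE → Γ ⊢ φ
  ⊗⊥NE   : ∀ {Γ φ} → Γ ⊢ φ ⊗ (⊥ᶠ ∧ᶠ NE) → Γ ⊢ ⊥ᶠ ∧ᶠ NE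
  ΘE     : ∀ {Γ n} (is : Vec ℕ n) (X Y : List (Vec Bool n)) →
           Unique (Data.Vec.toList is) → Unique X → Unique Y →
           ¬ (∀ s → (s ∈ X) ⇔ (s ∈ Y)) →
           Γ ⊢ Θ* is X ∧ᶠ Θ* is Y → Γ ⊢ ⊥ᶠ ∧ᶠ NE
  ⊗∨Dist : ∀ {Γ φ ψ χ} → Γ ⊢ φ ⊗ (ψ ∨ᶠ χ) → Γ ⊢ (φ ⊗ ψ) ∨ᶠ (φ ⊗ χ)
  NE⊗    : ∀ {Γ} (φs : List Form) →
           Γ ⊢ NE ∧ᶠ ⨂ φs →
           Γ ⊢ ⋁ (map (λ J → ⨂ (map (NE ∧ᶠ_) J)) (nonemptySublists φs))

Valuation : Set
Valuation = ℕ → Bool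

Team : Set₁
Team = Valuation → Set

infix 3 _⊨_

_⊨_ : Team → Form → Set₁
X ⊨ var i    = Lift _ (∀ s → X s → s i ≡ true)
X ⊨ nvar i   = Lift _ (∀ s → X s → s i ≡ false)
X ⊨ ⊥ᶠ       = Lift _ (∀ s → ¬ X s)
X ⊨ NE       = Lift _ (Σ Valuation X)
X ⊨ φ ∧ᶠ ψ   = (X ⊨ φ) × (X ⊨ ψ)
X ⊨ φ ⊗ ψ    = Σ Team λ Y → Σ Team λ Z →
                 (∀ s → X s ⇔ (Y s ⊎ Z s)) × (Y ⊨ φ) × (Z ⊨ ψ)
X ⊨ φ ∨ᶠ ψ   = (X ⊨ φ) ⊎ (X ⊨ ψ)

_⊫_ : Form → Form → Set₁
ψ ⊫ φ = ∀ (X : Team) → X ⊨ ψ → X ⊨ φ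

⊫_ : Form → Set₁
⊫ φ = ∀ (X : Team) → X ⊨ φ

-- Fix the finitely many variables of φ and ψ, and call a set of rows (assignments
-- to them) a team T with characteristic formula Θ*_T. From ax-NE, the axioms p ⊗ ¬p and NE⊗
-- one derives ⋁_T Θ*_T. Satisfaction of a formula by a team of rows is decidable; if T satisfies
-- φ then Θ*_T ⊢ φ, and otherwise Θ*_T, φ ⊢ ⊥ ∧ NE (for ⊗ this splits both components along the
-- ⋁_T Θ*_T and closes with ΘE). A team of rows satisfies φ exactly when the team of all
-- valuations restricting into it does, so ψ ⊨ φ yields ψ ⊢ φ disjunct by disjunct.
-- A valid formula then follows from the axiom p₀ ⊗ ¬p₀.

module Submission where

open import Defs
open import Data.Bool using (Bool; true; false)
import Data.Bool as Bool
open import Data.Empty using (⊥-elim)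
open import Data.List using (List; []; _∷_; map; _++_; deduplicate)
open import Data.List.Properties using (++-identityʳ; map-∘; map-++)
open import Data.List.Membership.Propositional using (_∈_; find; lose)
open import Data.List.Membership.Propositional.Properties
  using (∈-map⁺; ∈-map⁻; ∈-++⁻; ∈-++⁺ˡ; ∈-++⁺ʳ; ∈-deduplicate⁺; ∈-deduplicate⁻)
open import Data.List.Relation.Binary.Subset.Propositional using (_⊆_)
import Data.List.Relation.Binary.Subset.Propositional.Properties as ⊆
open import Data.List.Relation.Unary.All using (All; []; _∷_; all?)
import Data.List.Relation.Unary.All as All
open import Data.List.Relation.Unary.All.Properties.Core using (¬All⇒Any¬)
open import Data.List.Relation.Unary.AllPairs using ([]; _∷_)
open import Data.List.Relation.Unary.Any using (Any; here; there; any?)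
open import Data.List.Relation.Unary.Unique.Propositional using (Unique)
open import Data.List.Relation.Unary.Unique.DecPropositional.Properties using (deduplicate-!)
open import Data.Nat using (ℕ; zero; suc; _≟_)
open import Data.Product using (∃; _×_; _,_)
import Data.Product as Product
open import Data.Sum using (_⊎_; inj₁; inj₂)
import Data.Sum as Sum
open import Data.Unit using (⊤; tt)
open import Data.Vec using (Vec; []; _∷_; toList)
import Data.Vec as Vec
import Data.Vec.Properties as Vec
open import Function using (_∘_; id; case_of_)
open import Function.Bundles using (_⇔_; mk⇔; Equivalence)
open import Level using (lift)
open import Relation.Binary.Definitions using (DecidableEquality)
open import Relation.Binary.PropositionalEquality
  using (_≡_; _≢_; refl; sym; trans; subst; cong; cong₂; module ≡-Reasoning)
open import Relation.Nullary using (¬_; Dec; yes; no; contradiction)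
open import Relation.Nullary.Decidable using (_×-dec_; _⊎-dec_; decidable-stable; ¬¬-excluded-middle)

open ≡-Reasoning

infix 2 _⊩_

_⊩_ : Form → Form → Set
φ ⊩ ψ = (φ ∷ []) ⊢ ψ

⊥∧NE : Form
⊥∧NE = ⊥ᶠ ∧ᶠ NE

hyp : ∀ {φ} → φ ⊩ φ
hyp = assum (here refl)

weaken-∷ : ∀ {Γ φ ψ} → Γ ⊢ ψ → (φ ∷ Γ) ⊢ ψ
weaken-∷ = weaken there

weaken-under : ∀ {Γ φ ψ χ} → (φ ∷ Γ) ⊢ χ → (φ ∷ ψ ∷ Γ) ⊢ χ
weaken-under = weaken λ { (here p) → here p ; (there p) → there (there p) }

-- The system has no cut rule; ∨E applied to φ ∨ φ serves as one.
cut : ∀ {Γ φ ψ} → Γ ⊢ φ → (φ ∷ Γ) ⊢ ψ → Γ ⊢ ψ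
cut d e = ∨E (∨I₁ d) e e

infixl 5 _⟫_

_⟫_ : ∀ {Γ φ ψ} → Γ ⊢ φ → φ ⊩ ψ → Γ ⊢ ψ
d ⟫ e = cut d (weaken (λ { (here p) → here p }) e)

cut₂ : ∀ {Γ φ ψ χ} → Γ ⊢ φ → Γ ⊢ ψ → (φ ∷ ψ ∷ []) ⊢ χ → Γ ⊢ χ
cut₂ d e f = cut d (cut (weaken-∷ e) (weaken swap f))
  where
  swap : ∀ {Γ φ ψ} → (φ ∷ ψ ∷ []) ⊆ᶜ (ψ ∷ φ ∷ Γ)
  swap (here p)         = there (here p)
  swap (there (here p)) = here p

⊢-++-identityʳ : ∀ {Γ φ} → (Γ ++ []) ⊢ φ → Γ ⊢ φ
⊢-++-identityʳ {Γ} {φ} = subst (_⊢ φ) (++-identityʳ Γ)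

Classical⇒NoNE : ∀ {φ} → Classical φ → NoNE φ
Classical⇒NoNE (c-var i)  = n-var i
Classical⇒NoNE (c-nvar i) = n-nvar i
Classical⇒NoNE c-⊥        = n-⊥
Classical⇒NoNE (c-∧ c d)  = n-∧ (Classical⇒NoNE c) (Classical⇒NoNE d)
Classical⇒NoNE (c-⊗ c d)  = n-⊗ (Classical⇒NoNE c) (Classical⇒NoNE d)

⊗-elim : ∀ {Γ φ ψ α} → Classical α → Γ ⊢ φ ⊗ ψ → φ ⊩ α → ψ ⊩ α → Γ ⊢ α
⊗-elim c d e f = ⊢-++-identityʳ (⊗E c [] d e f)

⊗-mapʳ : ∀ {Γ φ ψ χ} → Γ ⊢ φ ⊗ ψ → ψ ⊩ χ → Γ ⊢ φ ⊗ χ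
⊗-mapʳ d e = ⊢-++-identityʳ (⊗Sub [] d e)

⊗-mapˡ : ∀ {Γ φ ψ χ} → Γ ⊢ φ ⊗ ψ → φ ⊩ χ → Γ ⊢ χ ⊗ ψ
⊗-mapˡ d e = ⊗Com (⊗-mapʳ (⊗Com d) e)

⊗-map : ∀ {Γ φ ψ φ′ ψ′} → Γ ⊢ φ ⊗ ψ → φ ⊩ φ′ → ψ ⊩ ψ′ → Γ ⊢ φ′ ⊗ ψ′
⊗-map d e f = ⊗-mapʳ (⊗-mapˡ d e) f

⊗-assocʳ : ∀ {Γ φ ψ χ} → Γ ⊢ (φ ⊗ ψ) ⊗ χ → Γ ⊢ φ ⊗ (ψ ⊗ χ)
⊗-assocʳ d = ⊗Com (⊗Ass (⊗Com (⊗Ass (⊗Com d))))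

⊗-swapˡ : ∀ {Γ φ ψ χ} → Γ ⊢ φ ⊗ (ψ ⊗ χ) → Γ ⊢ ψ ⊗ (φ ⊗ χ)
⊗-swapˡ d = ⊗-assocʳ (⊗-mapˡ (⊗Ass d) (⊗Com hyp))

⊗-identityˡ : ∀ {Γ φ} → Γ ⊢ ⊥ᶠ ⊗ φ → Γ ⊢ φ
⊗-identityˡ d = ⊗⊥E (⊗Com d)

⊥ᶠ⊩NoNE : ∀ {φ} → NoNE φ → ⊥ᶠ ⊩ φ
⊥ᶠ⊩NoNE n = ⊗-identityˡ (⊗I n hyp)

-- Case on ax-NE: under ⊥ the component NE strengthens to ⊥ ∧ NE, and ⊗⊥NE applies.
⊗-NE : ∀ {φ} → φ ⊗ NE ⊩ NE
⊗-NE {φ} = ∨E ax-NE (exfalso (⊗⊥NE φ⊗⊥∧NE)) (assum (here refl))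
  where
  φ⊗⊥∧NE : (⊥ᶠ ∷ (φ ⊗ NE) ∷ []) ⊢ φ ⊗ ⊥∧NE
  φ⊗⊥∧NE = weaken (λ { (here p) → there (here p) ; (there (here p)) → here p })
             (⊗Sub (c-⊥ ∷ []) hyp (∧I (assum (there (here refl))) (assum (here refl))))

⨂-uncons : ∀ φ φs → ⨂ (φ ∷ φs) ⊩ φ ⊗ ⨂ φs
⨂-uncons φ []      = ⊗I n-⊥ hyp
⨂-uncons φ (_ ∷ _) = hyp

⨂-cons : ∀ φ φs → φ ⊗ ⨂ φs ⊩ ⨂ (φ ∷ φs)
⨂-cons φ []      = ⊗⊥E hyp
⨂-cons φ (_ ∷ _) = hyp

⨂-++⁻ : ∀ φs ψs → ⨂ (φs ++ ψs) ⊩ ⨂ φs ⊗ ⨂ ψs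
⨂-++⁻ []       ψs = ⊗Com (⊗I n-⊥ hyp)
⨂-++⁻ (φ ∷ φs) ψs =
  ⊗Ass (⊗-mapʳ (⨂-uncons φ (φs ++ ψs)) (⨂-++⁻ φs ψs)) ⟫ ⊗-mapˡ hyp (⨂-cons φ φs)

⨂-++⁺ : ∀ φs ψs → ⨂ φs ⊗ ⨂ ψs ⊩ ⨂ (φs ++ ψs)
⨂-++⁺ []       ψs = ⊗-identityˡ hyp
⨂-++⁺ (φ ∷ φs) ψs =
  ⊗-mapʳ (⊗-assocʳ (⊗-mapˡ hyp (⨂-uncons φ φs))) (⨂-++⁺ φs ψs) ⟫ ⨂-cons φ (φs ++ ψs)

⨂-map⁺ : ∀ {A : Set} (f g : A → Form) → (∀ x → f x ⊩ g x) →
         ∀ xs → ⨂ (map f xs) ⊩ ⨂ (map g xs)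
⨂-map⁺ f g f⊩g []       = hyp
⨂-map⁺ f g f⊩g (x ∷ xs) =
  ⊗-map (⨂-uncons (f x) (map f xs)) (f⊩g x) (⨂-map⁺ f g f⊩g xs) ⟫ ⨂-cons (g x) (map g xs)

⨂-elim : ∀ {α} → Classical α → ∀ φs → (∀ {φ} → φ ∈ φs → φ ⊩ α) → ⨂ φs ⊩ α
⨂-elim c []           _   = ⊥ᶠ⊩NoNE (Classical⇒NoNE c)
⨂-elim c (φ ∷ [])     φ⊩α = φ⊩α (here refl)
⨂-elim c (φ ∷ ψ ∷ φs) φ⊩α = ⊗-elim c hyp (φ⊩α (here refl)) (⨂-elim c (ψ ∷ φs) (φ⊩α ∘ there))

-- A classical side assumption δ may be carried into the components by ⊗Sub.
⨂-refute : ∀ {δ φ} φs → Classical δ → φ ∈ φs →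
           (φ ∷ δ ∷ []) ⊢ ⊥∧NE → (⨂ φs ∷ δ ∷ []) ⊢ ⊥∧NE
⨂-refute (_ ∷ [])     c (here refl) e = e
⨂-refute (_ ∷ _ ∷ _)  c (here refl) e = ⊗⊥NE (⊗Sub (c ∷ []) (⊗Com hyp) e)
⨂-refute (_ ∷ ψ ∷ φs) c (there φ∈) e = ⊗⊥NE (⊗Sub (c ∷ []) hyp (⨂-refute (ψ ∷ φs) c φ∈ e))

Idempotent : List Form → Set
Idempotent φs = ∀ {φ} → φ ∈ φs → φ ⊗ φ ⊩ φ

⨂-pick : ∀ {φ} φs → φ ∈ φs → ⨂ φs ⊩ φ ⊗ ⨂ φs
⨂-pick (ψ ∷ φs) (here refl) = ⊗-mapʳ (⊗-assocʳ (⊗-mapˡ (⨂-uncons ψ φs) (⊗dup hyp))) (⨂-cons ψ φs)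
⨂-pick (ψ ∷ φs) (there φ∈) = ⊗-mapʳ (⊗-swapˡ (⊗-mapʳ (⨂-uncons ψ φs) (⨂-pick φs φ∈))) (⨂-cons ψ φs)

⨂-pick-⊆ : ∀ φs ψ ψs → (ψ ∷ ψs) ⊆ φs → ⨂ φs ⊩ ⨂ (ψ ∷ ψs) ⊗ ⨂ φs
⨂-pick-⊆ φs ψ []        ⊆φs = ⨂-pick φs (⊆φs (here refl))
⨂-pick-⊆ φs ψ (χ ∷ ψs) ⊆φs =
  ⊗Ass (⊗-swapˡ (⊗-mapʳ (⨂-pick-⊆ φs χ ψs (⊆φs ∘ there)) (⨂-pick φs (⊆φs (here refl)))))

⨂-absorb : ∀ {φ} ψs → φ ∈ ψs → Idempotent ψs → φ ⊗ ⨂ ψs ⊩ ⨂ ψs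
⨂-absorb (ψ ∷ ψs) (here refl) idem =
  ⊗-mapˡ (⊗Ass (⊗-mapʳ hyp (⨂-uncons ψ ψs))) (idem (here refl)) ⟫ ⨂-cons ψ ψs
⨂-absorb (ψ ∷ ψs) (there φ∈) idem =
  ⊗-mapʳ (⊗-swapˡ (⊗-mapʳ hyp (⨂-uncons ψ ψs))) (⨂-absorb ψs φ∈ (idem ∘ there)) ⟫ ⨂-cons ψ ψs

⨂-absorb-⊆ : ∀ φs ψs → φs ⊆ ψs → Idempotent ψs → ⨂ φs ⊗ ⨂ ψs ⊩ ⨂ ψs
⨂-absorb-⊆ []       ψs φs⊆ψs idem = ⊗-identityˡ hyp
⨂-absorb-⊆ (φ ∷ φs) ψs φs⊆ψs idem =
  ⊗-mapʳ (⊗-assocʳ (⊗-mapˡ hyp (⨂-uncons φ φs))) (⨂-absorb-⊆ φs ψs (φs⊆ψs ∘ there) idem)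
    ⟫ ⨂-absorb ψs (φs⊆ψs (here refl)) idem

-- Extra copies are made with ⊗dup and merged back by idempotence.
⨂-cong-⊆ : ∀ φs ψs → φs ⊆ ψs → ψs ⊆ φs → Idempotent ψs → ⨂ φs ⊩ ⨂ ψs
⨂-cong-⊆ []      []       _     _     _    = hyp
⨂-cong-⊆ (φ ∷ _) []       φs⊆ψs _     _    with () ← φs⊆ψs (here refl)
⨂-cong-⊆ φs      (ψ ∷ ψs) φs⊆ψs ψs⊆φs idem =
  ⊗Com (⨂-pick-⊆ φs ψ ψs ψs⊆φs) ⟫ ⨂-absorb-⊆ φs (ψ ∷ ψs) φs⊆ψs idem

⋁-intro : ∀ {Γ φ} φs → φ ∈ φs → Γ ⊢ φ → Γ ⊢ ⋁ φs
⋁-intro (_ ∷ [])    (here refl) d = d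
⋁-intro (_ ∷ _ ∷ _) (here refl) d = ∨I₁ d
⋁-intro (_ ∷ ψ ∷ φs) (there φ∈) d = ∨I₂ (⋁-intro (ψ ∷ φs) φ∈ d)

⋁-elim : ∀ {Γ χ} φs → Γ ⊢ ⋁ φs → (∀ {φ} → φ ∈ φs → (φ ∷ Γ) ⊢ χ) → Γ ⊢ χ
⋁-elim []           d cases = exfalso d
⋁-elim (_ ∷ [])     d cases = cut d (cases (here refl))
⋁-elim (_ ∷ ψ ∷ φs) d cases =
  ∨E d (cases (here refl)) (⋁-elim (ψ ∷ φs) (assum (here refl)) (weaken-under ∘ cases ∘ there))

⋁-elim-map : ∀ {A : Set} {Γ χ} (f : A → Form) xs → Γ ⊢ ⋁ (map f xs) →
             (∀ {x} → x ∈ xs → (f x ∷ Γ) ⊢ χ) → Γ ⊢ χ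
⋁-elim-map f xs d cases = ⋁-elim (map f xs) d λ fx∈ → case-map (∈-map⁻ f fx∈)
  where
  case-map : ∀ {φ} → ∃ (λ x → x ∈ xs × φ ≡ f x) → (φ ∷ _) ⊢ _
  case-map (x , x∈ , refl) = cases x∈

⊗-distribˡ-⋁ : ∀ {Γ φ} ψs → Γ ⊢ φ ⊗ ⋁ ψs → Γ ⊢ ⋁ (map (φ ⊗_) ψs)
⊗-distribˡ-⋁ []           d = ⊗⊥NE d
⊗-distribˡ-⋁ (_ ∷ [])     d = d
⊗-distribˡ-⋁ (_ ∷ ψ ∷ ψs) d =
  ∨E (⊗∨Dist d) (∨I₁ (assum (here refl))) (∨I₂ (⊗-distribˡ-⋁ (ψ ∷ ψs) (assum (here refl))))

⊗-⋁-elim : ∀ {A : Set} {Γ φ χ} (f : A → Form) xs → Γ ⊢ φ ⊗ ⋁ (map f xs) →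
           (∀ {x} → x ∈ xs → ((φ ⊗ f x) ∷ Γ) ⊢ χ) → Γ ⊢ χ
⊗-⋁-elim {Γ = Γ} {φ} f xs d =
  ⋁-elim-map (λ x → φ ⊗ f x) xs (subst (λ φs → Γ ⊢ ⋁ φs) (sym (map-∘ xs)) (⊗-distribˡ-⋁ (map f xs) d))

Row : ℕ → Set
Row n = Vec Bool n

extend : ∀ {n} → List (Row n) → List (Row (suc n))
extend []       = []
extend (r ∷ rs) = (true ∷ r) ∷ (false ∷ r) ∷ extend rs

allRows : ∀ n → List (Row n)
allRows zero    = [] ∷ []
allRows (suc n) = extend (allRows n)

∈-extend⁺ : ∀ {n} {r : Row n} b rs → r ∈ rs → (b ∷ r) ∈ extend rs
∈-extend⁺ true  (_ ∷ _)  (here refl) = here refl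
∈-extend⁺ false (_ ∷ _)  (here refl) = there (here refl)
∈-extend⁺ b     (_ ∷ rs) (there r∈)  = there (there (∈-extend⁺ b rs r∈))

∈-extend⁻ : ∀ {n} {r : Row n} {b} rs → (b ∷ r) ∈ extend rs → r ∈ rs
∈-extend⁻ (_ ∷ _)  (here refl)         = here refl
∈-extend⁻ (_ ∷ _)  (there (here refl)) = here refl
∈-extend⁻ (_ ∷ rs) (there (there r∈))  = there (∈-extend⁻ rs r∈)

∈-allRows : ∀ {n} (r : Row n) → r ∈ allRows n
∈-allRows []      = here refl
∈-allRows (b ∷ r) = ∈-extend⁺ b _ (∈-allRows r)

extend-unique : ∀ {n} (rs : List (Row n)) → Unique rs → Unique (extend rs)
extend-unique []       []           = []
extend-unique (r ∷ rs) (r∉ ∷ uniq) =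
  All.tabulate true∉ ∷ All.tabulate false∉ ∷ extend-unique rs uniq
  where
  false∉ : ∀ {r′} → r′ ∈ extend rs → (false ∷ r) ≢ r′
  false∉ r′∈ refl = All.lookup r∉ (∈-extend⁻ rs r′∈) refl
  true∉ : ∀ {r′} → r′ ∈ (false ∷ r) ∷ extend rs → (true ∷ r) ≢ r′
  true∉ (here refl) ()
  true∉ (there r′∈) refl = All.lookup r∉ (∈-extend⁻ rs r′∈) refl

allRows-unique : ∀ n → Unique (allRows n)
allRows-unique zero    = [] ∷ []
allRows-unique (suc n) = extend-unique _ (allRows-unique n)

sublists-⊆ : ∀ {A : Set} {ys : List A} xs → ys ∈ sublists xs → ys ⊆ xs
sublists-⊆ []       (here refl) ()
sublists-⊆ (x ∷ xs) ys∈ y∈ with ∈-++⁻ (sublists xs) ys∈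
... | inj₁ ys∈′ = there (sublists-⊆ xs ys∈′ y∈)
... | inj₂ x∷ys∈ with ∈-map⁻ (x ∷_) x∷ys∈
sublists-⊆ (x ∷ xs) _ (here refl) | inj₂ _ | _ , _ , refl = here refl
sublists-⊆ (x ∷ xs) _ (there y∈)  | inj₂ _ | _ , ys∈′ , refl = there (sublists-⊆ xs ys∈′ y∈)

sublists-unique : ∀ {A : Set} {ys : List A} xs → ys ∈ sublists xs → Unique xs → Unique ys
sublists-unique []       (here refl) _            = []
sublists-unique (x ∷ xs) ys∈         (x∉ ∷ uniq) with ∈-++⁻ (sublists xs) ys∈
... | inj₁ ys∈′ = sublists-unique xs ys∈′ uniq
... | inj₂ x∷ys∈ with ∈-map⁻ (x ∷_) x∷ys∈
... | _ , ys∈′ , refl =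
  All.tabulate (λ y∈ x≡y → All.lookup x∉ (sublists-⊆ xs ys∈′ y∈) x≡y) ∷ sublists-unique xs ys∈′ uniq

nonemptySublists⊆sublists : ∀ {A : Set} (xs : List A) → nonemptySublists xs ⊆ sublists xs
nonemptySublists⊆sublists (x ∷ xs) ys∈ with ∈-++⁻ (nonemptySublists xs) ys∈
... | inj₁ ys∈′ = ∈-++⁺ˡ (nonemptySublists⊆sublists xs ys∈′)
... | inj₂ ys∈′ = ∈-++⁺ʳ (sublists xs) ys∈′

sublists⊆[]∷nonemptySublists : ∀ {A : Set} (xs : List A) → sublists xs ⊆ [] ∷ nonemptySublists xs
sublists⊆[]∷nonemptySublists []       (here refl) = here refl
sublists⊆[]∷nonemptySublists (x ∷ xs) ys∈ with ∈-++⁻ (sublists xs) ys∈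
... | inj₂ ys∈′ = there (∈-++⁺ʳ (nonemptySublists xs) ys∈′)
... | inj₁ ys∈′ with sublists⊆[]∷nonemptySublists xs ys∈′
...   | here refl  = here refl
...   | there ys∈″ = there (∈-++⁺ˡ ys∈″)

module _ {A B : Set} (f : A → B) where

  private
    map-cons-map : ∀ x (yss : List (List A)) →
                   map (f x ∷_) (map (map f) yss) ≡ map (map f) (map (x ∷_) yss)
    map-cons-map x yss = trans (sym (map-∘ yss)) (map-∘ yss)

  map-sublists : ∀ xs → sublists (map f xs) ≡ map (map f) (sublists xs)
  map-sublists []       = refl
  map-sublists (x ∷ xs) = begin
    sublists (map f xs) ++ map (f x ∷_) (sublists (map f xs))
      ≡⟨ cong (λ yss → yss ++ map (f x ∷_) yss) (map-sublists xs) ⟩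
    map (map f) (sublists xs) ++ map (f x ∷_) (map (map f) (sublists xs))
      ≡⟨ cong (map (map f) (sublists xs) ++_) (map-cons-map x (sublists xs)) ⟩
    map (map f) (sublists xs) ++ map (map f) (map (x ∷_) (sublists xs))
      ≡⟨ map-++ (map f) (sublists xs) _ ⟨
    map (map f) (sublists (x ∷ xs)) ∎

  map-nonemptySublists : ∀ xs → nonemptySublists (map f xs) ≡ map (map f) (nonemptySublists xs)
  map-nonemptySublists []       = refl
  map-nonemptySublists (x ∷ xs) = begin
    nonemptySublists (map f xs) ++ map (f x ∷_) (sublists (map f xs))
      ≡⟨ cong₂ (λ yss zss → yss ++ map (f x ∷_) zss) (map-nonemptySublists xs) (map-sublists xs) ⟩
    map (map f) (nonemptySublists xs) ++ map (f x ∷_) (map (map f) (sublists xs))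
      ≡⟨ cong (map (map f) (nonemptySublists xs) ++_) (map-cons-map x (sublists xs)) ⟩
    map (map f) (nonemptySublists xs) ++ map (map f) (map (x ∷_) (sublists xs))
      ≡⟨ map-++ (map f) (nonemptySublists xs) _ ⟨
    map (map f) (nonemptySublists (x ∷ xs)) ∎

¬¬-sublist-filter : ∀ {A : Set} (P : A → Set) xs →
                    ¬ ¬ (∃ λ ys → ys ∈ sublists xs × (∀ y → y ∈ ys ⇔ (y ∈ xs × P y)))
¬¬-sublist-filter P []       k = k ([] , here refl , λ _ → mk⇔ (λ ()) (λ ()))
¬¬-sublist-filter P (x ∷ xs) k =
  ¬¬-sublist-filter P xs λ (ys , ys∈ , spec) → ¬¬-excluded-middle λ P?x → k (extend-filter ys ys∈ spec P?x)
  where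
  extend-filter : ∀ ys → ys ∈ sublists xs → (∀ y → y ∈ ys ⇔ (y ∈ xs × P y)) → Dec (P x) →
                  ∃ λ zs → zs ∈ sublists (x ∷ xs) × (∀ y → y ∈ zs ⇔ (y ∈ x ∷ xs × P y))
  extend-filter ys ys∈ spec (yes Px) =
    x ∷ ys , ∈-++⁺ʳ (sublists xs) (∈-map⁺ (x ∷_) ys∈) , λ y → mk⇔ (to′ y) (from′ y)
    where
    to′ : ∀ y → y ∈ x ∷ ys → y ∈ x ∷ xs × P y
    to′ y (here refl) = here refl , Px
    to′ y (there y∈)  = Product.map₁ there (Equivalence.to (spec y) y∈)
    from′ : ∀ y → y ∈ x ∷ xs × P y → y ∈ x ∷ ys
    from′ y (here refl , _) = here refl
    from′ y (there y∈ , Py) = there (Equivalence.from (spec y) (y∈ , Py))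
  extend-filter ys ys∈ spec (no ¬Px) = ys , ∈-++⁺ˡ ys∈ , λ y → mk⇔ (to′ y) (from′ y)
    where
    to′ : ∀ y → y ∈ ys → y ∈ x ∷ xs × P y
    to′ y y∈ = Product.map₁ there (Equivalence.to (spec y) y∈)
    from′ : ∀ y → y ∈ x ∷ xs × P y → y ∈ ys
    from′ y (here refl , Py) = contradiction Py ¬Px
    from′ y (there y∈ , Py)  = Equivalence.from (spec y) (y∈ , Py)

teams : ∀ n → List (List (Row n))
teams n = [] ∷ nonemptySublists (allRows n)

teams-unique : ∀ {n T} → T ∈ teams n → Unique T
teams-unique (here refl) = []
teams-unique {n} (there T∈) =
  sublists-unique (allRows n) (nonemptySublists⊆sublists (allRows n) T∈) (allRows-unique n)

-- The normal form ⋁_T Θ*_T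

lit-classical : ∀ i b → Classical (lit i b)
lit-classical i true  = c-var i
lit-classical i false = c-nvar i

-- rowFormula with its final NE replaced by the axiom p₀ ⊗ ¬p₀, so that it is classical
classicalRow : ∀ {n} → Vec ℕ n → Row n → Form
classicalRow []       []       = var 0 ⊗ nvar 0
classicalRow (i ∷ is) (b ∷ bs) = lit i b ∧ᶠ classicalRow is bs

classicalRow-classical : ∀ {n} (is : Vec ℕ n) r → Classical (classicalRow is r)
classicalRow-classical []       []       = c-⊗ (c-var 0) (c-nvar 0)
classicalRow-classical (i ∷ is) (b ∷ bs) = c-∧ (lit-classical i b) (classicalRow-classical is bs)

classicalRow-split : ∀ {n} i (is : Vec ℕ n) r →
  classicalRow is r ⊩ classicalRow (i ∷ is) (true ∷ r) ⊗ classicalRow (i ∷ is) (false ∷ r)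
classicalRow-split i is r =
  ⊗Com (weaken contract
    (⊗Sub (classical ∷ []) (⊗Com (⊗Sub {Γ = []} (classical ∷ []) (ax-em i) pair)) pair))
  where
  classical : Classical (classicalRow is r)
  classical = classicalRow-classical is r
  pair : ∀ {φ} → (φ ∷ classicalRow is r ∷ []) ⊢ φ ∧ᶠ classicalRow is r
  pair = ∧I (assum (here refl)) (assum (there (here refl)))
  contract : (classicalRow is r ∷ classicalRow is r ∷ []) ⊆ᶜ (classicalRow is r ∷ [])
  contract (here p)         = here p
  contract (there (here p)) = here p

⨂-extend : ∀ {n} (f : Row n → Form) (g : Row (suc n) → Form) →
           (∀ r → f r ⊩ g (true ∷ r) ⊗ g (false ∷ r)) →
           ∀ rs → ⨂ (map f rs) ⊩ ⨂ (map g (extend rs))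
⨂-extend f g split []       = hyp
⨂-extend f g split (r ∷ rs) =
  ⊗-mapʳ (⊗-assocʳ (⊗-map (⨂-uncons (f r) (map f rs)) (split r) (⨂-extend f g split rs)))
         (⨂-cons (g (false ∷ r)) (map g (extend rs)))

⊢⨂-classicalRows : ∀ {n} (is : Vec ℕ n) → [] ⊢ ⨂ (map (classicalRow is) (allRows n))
⊢⨂-classicalRows []       = ax-em 0
⊢⨂-classicalRows (i ∷ is) =
  ⊢⨂-classicalRows is
    ⟫ ⨂-extend (classicalRow is) (classicalRow (i ∷ is)) (classicalRow-split i is) (allRows _)

NE∧classicalRow⊩rowFormula : ∀ {n} (is : Vec ℕ n) r → NE ∧ᶠ classicalRow is r ⊩ rowFormula is r
NE∧classicalRow⊩rowFormula []       []       = ∧E₁ hyp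
NE∧classicalRow⊩rowFormula (i ∷ is) (b ∷ bs) =
  ∧I (∧E₁ (∧E₂ hyp)) (∧I (∧E₁ hyp) (∧E₂ (∧E₂ hyp)) ⟫ NE∧classicalRow⊩rowFormula is bs)

-- By ax-NE either the team is empty (Θ*_∅ = ⊥), or NE⊗ splits the derivable
-- ⨂ of all classical rows into the disjunction over nonempty sets of rows.
⊢⋁Θ* : ∀ {n} (is : Vec ℕ n) → [] ⊢ ⋁ (map (Θ* is) (teams n))
⊢⋁Θ* {n} is = ∨E ax-NE (⋁-intro (map (Θ* is) (teams n)) (here refl) (assum (here refl))) nonempty
  where
  NE∧rows : List (Row n) → Form
  NE∧rows T = ⨂ (map (NE ∧ᶠ_) (map (classicalRow is) T))

  NE⊢⋁NE∧rows : (NE ∷ []) ⊢ ⋁ (map NE∧rows (nonemptySublists (allRows n)))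
  NE⊢⋁NE∧rows = subst (λ φs → (NE ∷ []) ⊢ ⋁ φs)
    (trans (cong (map (⨂ ∘ map (NE ∧ᶠ_))) (map-nonemptySublists (classicalRow is) (allRows n)))
           (sym (map-∘ (nonemptySublists (allRows n)))))
    (NE⊗ (map (classicalRow is) (allRows n)) (∧I hyp (weaken (λ ()) (⊢⨂-classicalRows is))))

  NE∧rows⊩Θ* : ∀ T → NE∧rows T ⊩ Θ* is T
  NE∧rows⊩Θ* T = subst (λ φs → ⨂ φs ⊩ Θ* is T) (map-∘ T)
                       (⨂-map⁺ _ (rowFormula is) (NE∧classicalRow⊩rowFormula is) T)

  nonempty : (NE ∷ []) ⊢ ⋁ (map (Θ* is) (teams n))
  nonempty = ⋁-elim-map NE∧rows (nonemptySublists (allRows n)) NE⊢⋁NE∧rows λ {T} T∈ →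
    ⋁-intro (map (Θ* is) (teams n)) (there (∈-map⁺ (Θ* is) T∈)) (assum (here refl) ⟫ NE∧rows⊩Θ* T)

-- Indices outside `is` are sent to false.
toValuation : ∀ {n} → Vec ℕ n → Row n → Valuation
toValuation []       []       i = false
toValuation (j ∷ is) (b ∷ bs) i with i ≟ j
... | yes _ = b
... | no  _ = toValuation is bs i

restrict : ∀ {n} → Vec ℕ n → Valuation → Row n
restrict is s = Vec.map s is

toValuation-restrict : ∀ {n} (is : Vec ℕ n) s {i} → i ∈ toList is → toValuation is (restrict is s) i ≡ s i
toValuation-restrict (j ∷ is) s {i} i∈ with i ≟ j
toValuation-restrict (j ∷ is) s i∈          | yes refl = refl
toValuation-restrict (j ∷ is) s (here i≡j)  | no  i≢j  = contradiction i≡j i≢j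
toValuation-restrict (j ∷ is) s (there i∈)  | no  _    = toValuation-restrict is s i∈

toValuation-here : ∀ {n} j (is : Vec ℕ n) b bs → toValuation (j ∷ is) (b ∷ bs) j ≡ b
toValuation-here j is b bs with j ≟ j
... | yes _   = refl
... | no  j≢j = contradiction refl j≢j

toValuation-there : ∀ {n} j (is : Vec ℕ n) b bs {i} → j ≢ i →
                    toValuation (j ∷ is) (b ∷ bs) i ≡ toValuation is bs i
toValuation-there j is b bs {i} j≢i with i ≟ j
... | yes i≡j = contradiction (sym i≡j) j≢i
... | no  _   = refl

restrict-toValuation : ∀ {n} (is : Vec ℕ n) r → Unique (toList is) → restrict is (toValuation is r) ≡ r
restrict-toValuation []       []       _            = refl
restrict-toValuation (j ∷ is) (b ∷ bs) (j∉ ∷ uniq) =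
  cong₂ _∷_ (toValuation-here j is b bs) (trans (skip-j is j∉) (restrict-toValuation is bs uniq))
  where
  skip-j : ∀ {m} (ks : Vec ℕ m) → All (j ≢_) (toList ks) →
           restrict ks (toValuation (j ∷ is) (b ∷ bs)) ≡ restrict ks (toValuation is bs)
  skip-j []       _            = refl
  skip-j (k ∷ ks) (j≢k ∷ j∉ks) = cong₂ _∷_ (toValuation-there j is b bs j≢k) (skip-j ks j∉ks)

rowFormula⊩lit : ∀ {n} (is : Vec ℕ n) r {i} → i ∈ toList is → rowFormula is r ⊩ lit i (toValuation is r i)
rowFormula⊩lit (j ∷ is) (b ∷ bs) {i} i∈ with i ≟ j
rowFormula⊩lit (j ∷ is) (b ∷ bs) i∈         | yes refl = ∧E₁ hyp
rowFormula⊩lit (j ∷ is) (b ∷ bs) (here i≡j) | no  i≢j  = contradiction i≡j i≢j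
rowFormula⊩lit (j ∷ is) (b ∷ bs) (there i∈) | no  _    = ∧E₂ hyp ⟫ rowFormula⊩lit is bs i∈

rowFormula⊩NE : ∀ {n} (is : Vec ℕ n) r → rowFormula is r ⊩ NE
rowFormula⊩NE []       []       = hyp
rowFormula⊩NE (j ∷ is) (b ∷ bs) = ∧E₂ hyp ⟫ rowFormula⊩NE is bs

rowFormula-idem : ∀ {n} (is : Vec ℕ n) r → rowFormula is r ⊗ rowFormula is r ⊩ rowFormula is r
rowFormula-idem []       []       = ⊗-NE
rowFormula-idem (j ∷ is) (b ∷ bs) =
  ∧I (⊗-elim (lit-classical j b) hyp (∧E₁ hyp) (∧E₁ hyp))
     (⊗-map hyp (∧E₂ hyp) (∧E₂ hyp) ⟫ rowFormula-idem is bs)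

lit-clash : ∀ {Γ} i {b c} → b ≢ c → Γ ⊢ lit i b → Γ ⊢ lit i c → Γ ⊢ ⊥ᶠ
lit-clash i {true}  {true}  b≢c = contradiction refl b≢c
lit-clash i {true}  {false} _   = λ pᵢ ¬pᵢ → contr i (∧I pᵢ ¬pᵢ)
lit-clash i {false} {true}  _   = λ ¬pᵢ pᵢ → contr i (∧I pᵢ ¬pᵢ)
lit-clash i {false} {false} b≢c = contradiction refl b≢c

rowFormula-refutes-lit : ∀ {n} (is : Vec ℕ n) r {i b} → i ∈ toList is → toValuation is r i ≢ b →
                         (rowFormula is r ∷ lit i b ∷ []) ⊢ ⊥∧NE
rowFormula-refutes-lit is r i∈ r≢b =
  ∧I (lit-clash _ r≢b (assum (here refl) ⟫ rowFormula⊩lit is r i∈) (assum (there (here refl))))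
     (assum (here refl) ⟫ rowFormula⊩NE is r)

module _ {n} (is : Vec ℕ n) where

  private
    ∈-rowFormulas⁻ : ∀ {φ T} → φ ∈ map (rowFormula is) T → ∃ λ r → r ∈ T × φ ≡ rowFormula is r
    ∈-rowFormulas⁻ = ∈-map⁻ (rowFormula is)

  Θ*-idempotent : ∀ T → Idempotent (map (rowFormula is) T)
  Θ*-idempotent T φ∈ with ∈-rowFormulas⁻ φ∈
  ... | r , _ , refl = rowFormula-idem is r

  Θ*⊩lit : ∀ T {i b} → i ∈ toList is → All (λ r → toValuation is r i ≡ b) T → Θ* is T ⊩ lit i b
  Θ*⊩lit T {i} {b} i∈ values = ⨂-elim (lit-classical i b) (map (rowFormula is) T) row⊩lit
    where
    row⊩lit : ∀ {φ} → φ ∈ map (rowFormula is) T → φ ⊩ lit i b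
    row⊩lit φ∈ with ∈-rowFormulas⁻ φ∈
    ... | r , r∈ , refl =
      subst (λ c → rowFormula is r ⊩ lit i c) (All.lookup values r∈) (rowFormula⊩lit is r i∈)

  Θ*⊩NE : ∀ r T → Θ* is (r ∷ T) ⊩ NE
  Θ*⊩NE r T =
    ⊗-mapʳ (⊗Com (⨂-uncons (rowFormula is r) (map (rowFormula is) T))) (rowFormula⊩NE is r) ⟫ ⊗-NE

  Θ*-refutes : ∀ {r T δ} → r ∈ T → Classical δ → (rowFormula is r ∷ δ ∷ []) ⊢ ⊥∧NE →
               (Θ* is T ∷ δ ∷ []) ⊢ ⊥∧NE
  Θ*-refutes {T = T} r∈ c = ⨂-refute (map (rowFormula is) T) c (∈-map⁺ (rowFormula is) r∈)

  Θ*-refutes-lit : ∀ T {i b} → i ∈ toList is → ¬ All (λ r → toValuation is r i ≡ b) T →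
                   (Θ* is T ∷ lit i b ∷ []) ⊢ ⊥∧NE
  Θ*-refutes-lit T {i} {b} i∈ ¬values with find (¬All⇒Any¬ (λ r → toValuation is r i Bool.≟ b) T ¬values)
  ... | r , r∈ , r≢b = Θ*-refutes r∈ (lit-classical i b) (rowFormula-refutes-lit is r i∈ r≢b)

  Θ*-cong-⊆ : ∀ T U → T ⊆ U → U ⊆ T → Θ* is T ⊩ Θ* is U
  Θ*-cong-⊆ T U T⊆U U⊆T =
    ⨂-cong-⊆ (map (rowFormula is) T) (map (rowFormula is) U)
             (⊆.map⁺ (rowFormula is) T⊆U) (⊆.map⁺ (rowFormula is) U⊆T) (Θ*-idempotent U)

  Θ*-++⁻ : ∀ Y Z → Θ* is (Y ++ Z) ⊩ Θ* is Y ⊗ Θ* is Z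
  Θ*-++⁻ Y Z = subst (λ φs → ⨂ φs ⊩ Θ* is Y ⊗ Θ* is Z) (sym (map-++ (rowFormula is) Y Z))
                     (⨂-++⁻ (map (rowFormula is) Y) (map (rowFormula is) Z))

  Θ*-++⁺ : ∀ Y Z → Θ* is Y ⊗ Θ* is Z ⊩ Θ* is (Y ++ Z)
  Θ*-++⁺ Y Z = subst (λ φs → Θ* is Y ⊗ Θ* is Z ⊩ ⨂ φs) (sym (map-++ (rowFormula is) Y Z))
                     (⨂-++⁺ (map (rowFormula is) Y) (map (rowFormula is) Z))

VarsIn : List ℕ → Form → Set
VarsIn L (var i)  = i ∈ L
VarsIn L (nvar i) = i ∈ L
VarsIn L ⊥ᶠ       = ⊤
VarsIn L NE       = ⊤
VarsIn L (φ ∧ᶠ ψ) = VarsIn L φ × VarsIn L ψ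
VarsIn L (φ ⊗ ψ)  = VarsIn L φ × VarsIn L ψ
VarsIn L (φ ∨ᶠ ψ) = VarsIn L φ × VarsIn L ψ

vars : Form → List ℕ
vars (var i)  = i ∷ []
vars (nvar i) = i ∷ []
vars ⊥ᶠ       = []
vars NE       = []
vars (φ ∧ᶠ ψ) = vars φ ++ vars ψ
vars (φ ⊗ ψ)  = vars φ ++ vars ψ
vars (φ ∨ᶠ ψ) = vars φ ++ vars ψ

vars⊆⇒VarsIn : ∀ {L} φ → vars φ ⊆ L → VarsIn L φ
vars⊆⇒VarsIn (var i)  vars⊆ = vars⊆ (here refl)
vars⊆⇒VarsIn (nvar i) vars⊆ = vars⊆ (here refl)
vars⊆⇒VarsIn ⊥ᶠ       _     = tt
vars⊆⇒VarsIn NE       _     = tt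
vars⊆⇒VarsIn (φ ∧ᶠ ψ) vars⊆ = vars⊆⇒VarsIn φ (vars⊆ ∘ ∈-++⁺ˡ) , vars⊆⇒VarsIn ψ (vars⊆ ∘ ∈-++⁺ʳ (vars φ))
vars⊆⇒VarsIn (φ ⊗ ψ)  vars⊆ = vars⊆⇒VarsIn φ (vars⊆ ∘ ∈-++⁺ˡ) , vars⊆⇒VarsIn ψ (vars⊆ ∘ ∈-++⁺ʳ (vars φ))
vars⊆⇒VarsIn (φ ∨ᶠ ψ) vars⊆ = vars⊆⇒VarsIn φ (vars⊆ ∘ ∈-++⁺ˡ) , vars⊆⇒VarsIn ψ (vars⊆ ∘ ∈-++⁺ʳ (vars φ))

-- Team semantics on rows

module RowSemantics {n} (is : Vec ℕ n) (is-unique : Unique (toList is)) where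

  _≟ᵣ_ : DecidableEquality (Row n)
  _≟ᵣ_ = Vec.≡-dec Bool._≟_

  open import Data.List.Relation.Binary.Subset.DecPropositional _≟ᵣ_ using (_⊆?_)

  value : Row n → ℕ → Bool
  value = toValuation is

  Scoped : Form → Set
  Scoped = VarsIn (toList is)

  -- The components of a ⊗-split range over the finite list `teams n`, so that
  -- satisfaction is decidable.
  infix 3 _⊨ᶠ_ _⊨ᶠ?_

  _⊨ᶠ_ : List (Row n) → Form → Set
  T ⊨ᶠ var i    = All (λ r → value r i ≡ true) T
  T ⊨ᶠ nvar i   = All (λ r → value r i ≡ false) T
  T ⊨ᶠ ⊥ᶠ       = T ≡ []
  T ⊨ᶠ NE       = T ≢ []
  T ⊨ᶠ φ ∧ᶠ ψ   = T ⊨ᶠ φ × T ⊨ᶠ ψ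
  T ⊨ᶠ φ ⊗ ψ    = Any (λ Y → Any (λ Z → (T ⊆ Y ++ Z × Y ++ Z ⊆ T) × Y ⊨ᶠ φ × Z ⊨ᶠ ψ) (teams n)) (teams n)
  T ⊨ᶠ φ ∨ᶠ ψ   = T ⊨ᶠ φ ⊎ T ⊨ᶠ ψ

  _⊨ᶠ?_ : ∀ T φ → Dec (T ⊨ᶠ φ)
  T       ⊨ᶠ? var i    = all? (λ r → value r i Bool.≟ true) T
  T       ⊨ᶠ? nvar i   = all? (λ r → value r i Bool.≟ false) T
  []      ⊨ᶠ? ⊥ᶠ       = yes refl
  (_ ∷ _) ⊨ᶠ? ⊥ᶠ       = no λ ()
  []      ⊨ᶠ? NE       = no λ []≢[] → []≢[] refl
  (_ ∷ _) ⊨ᶠ? NE       = yes λ ()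
  T       ⊨ᶠ? φ ∧ᶠ ψ   = T ⊨ᶠ? φ ×-dec T ⊨ᶠ? ψ
  T       ⊨ᶠ? φ ⊗ ψ    = any? (λ Y → any? (λ Z →
                           (T ⊆? Y ++ Z ×-dec Y ++ Z ⊆? T) ×-dec Y ⊨ᶠ? φ ×-dec Z ⊨ᶠ? ψ)
                         (teams n)) (teams n)
  T       ⊨ᶠ? φ ∨ᶠ ψ   = T ⊨ᶠ? φ ⊎-dec T ⊨ᶠ? ψ

  ⊨ᶠ⇒Θ*⊩ : ∀ T φ → Scoped φ → T ⊨ᶠ φ → Θ* is T ⊩ φ
  ⊨ᶠ⇒Θ*⊩ T       (var i)  i∈ T⊨ = Θ*⊩lit is T i∈ T⊨
  ⊨ᶠ⇒Θ*⊩ T       (nvar i) i∈ T⊨ = Θ*⊩lit is T i∈ T⊨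
  ⊨ᶠ⇒Θ*⊩ .[]     ⊥ᶠ       _  refl = hyp
  ⊨ᶠ⇒Θ*⊩ []      NE       _  []≢[] = contradiction refl []≢[]
  ⊨ᶠ⇒Θ*⊩ (r ∷ T) NE       _  _  = Θ*⊩NE is r T
  ⊨ᶠ⇒Θ*⊩ T (φ ∧ᶠ ψ) (sφ , sψ) (T⊨φ , T⊨ψ) = ∧I (⊨ᶠ⇒Θ*⊩ T φ sφ T⊨φ) (⊨ᶠ⇒Θ*⊩ T ψ sψ T⊨ψ)
  ⊨ᶠ⇒Θ*⊩ T (φ ∨ᶠ ψ) (sφ , sψ) (inj₁ T⊨φ) = ∨I₁ (⊨ᶠ⇒Θ*⊩ T φ sφ T⊨φ)
  ⊨ᶠ⇒Θ*⊩ T (φ ∨ᶠ ψ) (sφ , sψ) (inj₂ T⊨ψ) = ∨I₂ (⊨ᶠ⇒Θ*⊩ T ψ sψ T⊨ψ)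
  ⊨ᶠ⇒Θ*⊩ T (φ ⊗ ψ)  (sφ , sψ) T⊨ with find T⊨
  ... | Y , _ , Y⊨ with find Y⊨
  ... | Z , _ , (T⊆ , ⊆T) , Y⊨φ , Z⊨ψ =
    ⊗-map (Θ*-cong-⊆ is T (Y ++ Z) T⊆ ⊆T ⟫ Θ*-++⁻ is Y Z) (⊨ᶠ⇒Θ*⊩ Y φ sφ Y⊨φ) (⊨ᶠ⇒Θ*⊩ Z ψ sψ Z⊨ψ)

  ⊩⋁Θ*∧ : ∀ φ → φ ⊩ ⋁ (map (λ T → Θ* is T ∧ᶠ φ) (teams n))
  ⊩⋁Θ*∧ φ = ⋁-elim-map (Θ* is) (teams n) (weaken (λ ()) (⊢⋁Θ* is)) λ T∈ →
    ⋁-intro (map (λ T → Θ* is T ∧ᶠ φ) (teams n)) (∈-map⁺ _ T∈)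
            (∧I (assum (here refl)) (assum (there (here refl))))

  ⊗-cases : ∀ {Γ φ ψ χ} → Γ ⊢ φ ⊗ ψ →
            (∀ {Y Z} → Y ∈ teams n → Z ∈ teams n → (((Θ* is Y ∧ᶠ φ) ⊗ (Θ* is Z ∧ᶠ ψ)) ∷ Γ) ⊢ χ) → Γ ⊢ χ
  ⊗-cases {φ = φ} {ψ} d k =
    ⊗-⋁-elim (λ Y → Θ* is Y ∧ᶠ φ) (teams n) (⊗Com (⊗-map d (⊩⋁Θ*∧ φ) (⊩⋁Θ*∧ ψ))) λ Y∈ →
    ⊗-⋁-elim (λ Z → Θ* is Z ∧ᶠ ψ) (teams n) (⊗Com (assum (here refl))) λ Z∈ →
    weaken-under (k Y∈ Z∈)

  ⊭ᶠ⇒refutes : ∀ {Γ} T φ → Unique T → Scoped φ → ¬ (T ⊨ᶠ φ) → Γ ⊢ Θ* is T → Γ ⊢ φ → Γ ⊢ ⊥∧NE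
  ⊭ᶠ⇒refutes-⊗ : ∀ {Γ} T φ ψ {Y Z} → Y ∈ teams n → Z ∈ teams n → Unique T → Scoped φ → Scoped ψ →
                 ¬ (T ⊨ᶠ φ ⊗ ψ) → Γ ⊢ Θ* is T → Γ ⊢ (Θ* is Y ∧ᶠ φ) ⊗ (Θ* is Z ∧ᶠ ψ) → Γ ⊢ ⊥∧NE

  ⊭ᶠ⇒refutes T (var i)  _ i∈ T⊭ ⊢Θ* ⊢φ = cut₂ ⊢Θ* ⊢φ (Θ*-refutes-lit is T i∈ T⊭)
  ⊭ᶠ⇒refutes T (nvar i) _ i∈ T⊭ ⊢Θ* ⊢φ = cut₂ ⊢Θ* ⊢φ (Θ*-refutes-lit is T i∈ T⊭)
  ⊭ᶠ⇒refutes []      ⊥ᶠ _ _ T⊭ _ _ = contradiction refl T⊭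
  ⊭ᶠ⇒refutes (r ∷ T) ⊥ᶠ _ _ _ ⊢Θ* ⊢φ =
    cut₂ ⊢Θ* ⊢φ (Θ*-refutes is {T = r ∷ T} (here refl) c-⊥
                   (∧I (assum (there (here refl))) (assum (here refl) ⟫ rowFormula⊩NE is r)))
  ⊭ᶠ⇒refutes []      NE _ _ _   ⊢Θ* ⊢φ = ∧I ⊢Θ* ⊢φ
  ⊭ᶠ⇒refutes (r ∷ T) NE _ _ T⊭ _   _  = contradiction (λ ()) T⊭
  ⊭ᶠ⇒refutes T (φ ∧ᶠ ψ) uniq (sφ , sψ) T⊭ ⊢Θ* ⊢φ∧ψ with T ⊨ᶠ? φ
  ... | no  T⊭φ = ⊭ᶠ⇒refutes T φ uniq sφ T⊭φ ⊢Θ* (∧E₁ ⊢φ∧ψ)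
  ... | yes T⊨φ = ⊭ᶠ⇒refutes T ψ uniq sψ (T⊭ ∘ (T⊨φ ,_)) ⊢Θ* (∧E₂ ⊢φ∧ψ)
  ⊭ᶠ⇒refutes T (φ ∨ᶠ ψ) uniq (sφ , sψ) T⊭ ⊢Θ* ⊢φ∨ψ =
    ∨E ⊢φ∨ψ (⊭ᶠ⇒refutes T φ uniq sφ (T⊭ ∘ inj₁) (weaken-∷ ⊢Θ*) (assum (here refl)))
            (⊭ᶠ⇒refutes T ψ uniq sψ (T⊭ ∘ inj₂) (weaken-∷ ⊢Θ*) (assum (here refl)))
  ⊭ᶠ⇒refutes T (φ ⊗ ψ) uniq (sφ , sψ) T⊭ ⊢Θ* ⊢φ⊗ψ = ⊗-cases ⊢φ⊗ψ λ Y∈ Z∈ →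
    ⊭ᶠ⇒refutes-⊗ T φ ψ Y∈ Z∈ uniq sφ sψ T⊭ (weaken-∷ ⊢Θ*) (assum (here refl))

  -- If both components are satisfied, Θ*_T and Θ*_(Y ∪ Z) are conjoined with T ≠ Y ∪ Z, and ΘE applies.
  ⊭ᶠ⇒refutes-⊗ T φ ψ {Y} {Z} Y∈ Z∈ uniq sφ sψ T⊭ ⊢Θ* ⊢⊗ with Y ⊨ᶠ? φ | Z ⊨ᶠ? ψ
  ... | no Y⊭φ | _ =
    ⊗⊥NE (⊗Com (⊗-mapˡ ⊢⊗ (⊭ᶠ⇒refutes Y φ (teams-unique Y∈) sφ Y⊭φ (∧E₁ hyp) (∧E₂ hyp))))
  ... | yes _ | no Z⊭ψ =
    ⊗⊥NE (⊗-mapʳ ⊢⊗ (⊭ᶠ⇒refutes Z ψ (teams-unique Z∈) sψ Z⊭ψ (∧E₁ hyp) (∧E₂ hyp)))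
  ... | yes Y⊨φ | yes Z⊨ψ =
    ΘE is T Y∪Z is-unique uniq (deduplicate-! _≟ᵣ_ (Y ++ Z)) T≉Y∪Z
       (∧I ⊢Θ* (⊗-map ⊢⊗ (∧E₁ hyp) (∧E₁ hyp)
                  ⟫ Θ*-++⁺ is Y Z ⟫ Θ*-cong-⊆ is (Y ++ Z) Y∪Z ∈-dedup⁺ ∈-dedup⁻))
    where
    Y∪Z : List (Row n)
    Y∪Z = deduplicate _≟ᵣ_ (Y ++ Z)
    ∈-dedup⁺ : Y ++ Z ⊆ Y∪Z
    ∈-dedup⁺ = ∈-deduplicate⁺ _≟ᵣ_
    ∈-dedup⁻ : Y∪Z ⊆ Y ++ Z
    ∈-dedup⁻ = ∈-deduplicate⁻ _≟ᵣ_ (Y ++ Z)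
    T≉Y∪Z : ¬ (∀ r → r ∈ T ⇔ r ∈ Y∪Z)
    T≉Y∪Z T≈ = T⊭ (lose Y∈ (lose Z∈ ((T⊆ , ⊆T) , Y⊨φ , Z⊨ψ)))
      where
      T⊆ : T ⊆ Y ++ Z
      T⊆ = ∈-dedup⁻ ∘ Equivalence.to (T≈ _)
      ⊆T : Y ++ Z ⊆ T
      ⊆T = Equivalence.from (T≈ _) ∘ ∈-dedup⁺

  record Image (X : Team) (T : List (Row n)) : Set where
    field
      restrict∈ : ∀ {s} → X s → restrict is s ∈ T
      onto      : ∀ {r} → r ∈ T → ∃ λ s → X s × restrict is s ≡ r
  open Image

  preimage-Image : ∀ T → Image (λ s → restrict is s ∈ T) T
  preimage-Image T = record
    { restrict∈ = id
    ; onto      = λ {r} r∈ → toValuation is r , subst (_∈ T) (sym (restrict∘toValuation r)) r∈ ,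
                               restrict∘toValuation r
    }
    where
    restrict∘toValuation : ∀ r → restrict is (toValuation is r) ≡ r
    restrict∘toValuation r = restrict-toValuation is r is-unique

  ¬¬-Image : ∀ X → ¬ ¬ (∃ λ T → T ∈ teams n × Image X T)
  ¬¬-Image X k = ¬¬-sublist-filter (λ r → ∃ λ s → X s × restrict is s ≡ r) (allRows n) λ (T , T∈ , spec) →
    k (T , sublists⊆[]∷nonemptySublists (allRows n) T∈ , record
      { restrict∈ = λ {s} x → Equivalence.from (spec _) (∈-allRows _ , s , x , refl)
      ; onto      = λ r∈ → Product.proj₂ (Equivalence.to (spec _) r∈)
      })

  Image-⊆ : ∀ {X T W} → Image X T → W ⊆ T → Image (λ s → X s × restrict is s ∈ W) W
  Image-⊆ {X} {T} {W} img W⊆T = record { restrict∈ = Product.proj₂ ; onto = onto′ }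
    where
    onto′ : ∀ {r} → r ∈ W → ∃ λ s → (X s × restrict is s ∈ W) × restrict is s ≡ r
    onto′ r∈ with onto img (W⊆T r∈)
    ... | s , x , refl = s , (x , r∈) , refl

  Image-∪ : ∀ {X Y Z T U V} → (∀ s → X s ⇔ (Y s ⊎ Z s)) → Image X T → Image Y U → Image Z V →
            T ⊆ U ++ V × U ++ V ⊆ T
  Image-∪ {T = T} {U} {V} X⇔Y∪Z imgX imgY imgZ = T⊆ , ⊆T
    where
    T⊆ : T ⊆ U ++ V
    T⊆ r∈ with onto imgX r∈
    ... | s , x , refl with Equivalence.to (X⇔Y∪Z s) x
    ...   | inj₁ y = ∈-++⁺ˡ (restrict∈ imgY y)
    ...   | inj₂ z = ∈-++⁺ʳ U (restrict∈ imgZ z)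
    ⊆T : U ++ V ⊆ T
    ⊆T r∈ with ∈-++⁻ U r∈
    ... | inj₁ r∈U with onto imgY r∈U
    ...   | s , y , refl = restrict∈ imgX (Equivalence.from (X⇔Y∪Z s) (inj₁ y))
    ⊆T r∈ | inj₂ r∈V with onto imgZ r∈V
    ...   | s , z , refl = restrict∈ imgX (Equivalence.from (X⇔Y∪Z s) (inj₂ z))

  ⊨ᶠ⇒⊨ : ∀ T φ → Scoped φ → T ⊨ᶠ φ → ∀ X → Image X T → X ⊨ φ
  ⊨ᶠ⇒⊨ T (var i)  i∈ T⊨ X img =
    lift λ s x → trans (sym (toValuation-restrict is s i∈)) (All.lookup T⊨ (restrict∈ img x))
  ⊨ᶠ⇒⊨ T (nvar i) i∈ T⊨ X img =
    lift λ s x → trans (sym (toValuation-restrict is s i∈)) (All.lookup T⊨ (restrict∈ img x))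
  ⊨ᶠ⇒⊨ .[] ⊥ᶠ _ refl X img = lift λ s x → case restrict∈ img x of λ ()
  ⊨ᶠ⇒⊨ []      NE _ []≢[] X img = contradiction refl []≢[]
  ⊨ᶠ⇒⊨ (r ∷ T) NE _ _     X img = lift (Product.map₂ Product.proj₁ (onto img (here refl)))
  ⊨ᶠ⇒⊨ T (φ ∧ᶠ ψ) (sφ , sψ) (T⊨φ , T⊨ψ) X img = ⊨ᶠ⇒⊨ T φ sφ T⊨φ X img , ⊨ᶠ⇒⊨ T ψ sψ T⊨ψ X img
  ⊨ᶠ⇒⊨ T (φ ∨ᶠ ψ) (sφ , sψ) (inj₁ T⊨φ) X img = inj₁ (⊨ᶠ⇒⊨ T φ sφ T⊨φ X img)
  ⊨ᶠ⇒⊨ T (φ ∨ᶠ ψ) (sφ , sψ) (inj₂ T⊨ψ) X img = inj₂ (⊨ᶠ⇒⊨ T ψ sψ T⊨ψ X img)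
  ⊨ᶠ⇒⊨ T (φ ⊗ ψ)  (sφ , sψ) T⊨ X img with find T⊨
  ... | Y , _ , Y⊨ with find Y⊨
  ... | Z , _ , (T⊆ , ⊆T) , Y⊨φ , Z⊨ψ =
    X∩Y , X∩Z , (λ s → mk⇔ (split s) merge) ,
    ⊨ᶠ⇒⊨ Y φ sφ Y⊨φ X∩Y (Image-⊆ img (⊆T ∘ ∈-++⁺ˡ)) , ⊨ᶠ⇒⊨ Z ψ sψ Z⊨ψ X∩Z (Image-⊆ img (⊆T ∘ ∈-++⁺ʳ Y))
    where
    X∩Y X∩Z : Team
    X∩Y s = X s × restrict is s ∈ Y
    X∩Z s = X s × restrict is s ∈ Z
    split : ∀ s → X s → X∩Y s ⊎ X∩Z s
    split s x = Sum.map (x ,_) (x ,_) (∈-++⁻ Y (T⊆ (restrict∈ img x)))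
    merge : ∀ {s} → X∩Y s ⊎ X∩Z s → X s
    merge = Sum.[ Product.proj₁ , Product.proj₁ ]

  -- The semantic team X is arbitrary, so the teams of rows of its ⊗-components
  -- exist only up to double negation; decidability of ⊨ᶠ removes it.
  ⊨⇒⊨ᶠ : ∀ T φ → Scoped φ → ∀ X → Image X T → X ⊨ φ → T ⊨ᶠ φ
  ⊨⇒⊨ᶠ T (var i) i∈ X img (lift X⊨) = All.tabulate λ r∈ → case onto img r∈ of λ
    { (s , x , refl) → trans (toValuation-restrict is s i∈) (X⊨ s x) }
  ⊨⇒⊨ᶠ T (nvar i) i∈ X img (lift X⊨) = All.tabulate λ r∈ → case onto img r∈ of λ
    { (s , x , refl) → trans (toValuation-restrict is s i∈) (X⊨ s x) }
  ⊨⇒⊨ᶠ []      ⊥ᶠ _ X img _          = refl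
  ⊨⇒⊨ᶠ (r ∷ T) ⊥ᶠ _ X img (lift X⊨) = case onto img (here refl) of λ { (s , x , _) → ⊥-elim (X⊨ s x) }
  ⊨⇒⊨ᶠ T NE _ X img (lift (s , x)) refl = case restrict∈ img x of λ ()
  ⊨⇒⊨ᶠ T (φ ∧ᶠ ψ) (sφ , sψ) X img (X⊨φ , X⊨ψ) = ⊨⇒⊨ᶠ T φ sφ X img X⊨φ , ⊨⇒⊨ᶠ T ψ sψ X img X⊨ψ
  ⊨⇒⊨ᶠ T (φ ∨ᶠ ψ) (sφ , sψ) X img (inj₁ X⊨φ) = inj₁ (⊨⇒⊨ᶠ T φ sφ X img X⊨φ)
  ⊨⇒⊨ᶠ T (φ ∨ᶠ ψ) (sφ , sψ) X img (inj₂ X⊨ψ) = inj₂ (⊨⇒⊨ᶠ T ψ sψ X img X⊨ψ)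
  ⊨⇒⊨ᶠ T (φ ⊗ ψ)  (sφ , sψ) X img (Y , Z , X⇔Y∪Z , Y⊨φ , Z⊨ψ) =
    decidable-stable (T ⊨ᶠ? φ ⊗ ψ) λ k →
      ¬¬-Image Y λ (U , U∈ , imgY) →
      ¬¬-Image Z λ (V , V∈ , imgZ) →
      k (lose U∈ (lose V∈ (Image-∪ X⇔Y∪Z img imgY imgZ ,
                           ⊨⇒⊨ᶠ U φ sφ Y imgY Y⊨φ , ⊨⇒⊨ᶠ V ψ sψ Z imgZ Z⊨ψ)))

  ⊫⇒⊩ : ∀ φ ψ → Scoped φ → Scoped ψ → ψ ⊫ φ → ψ ⊩ φ
  ⊫⇒⊩ φ ψ sφ sψ ψ⊫φ = ⋁-elim-map (Θ* is) (teams n) (weaken (λ ()) (⊢⋁Θ* is)) by-team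
    where
    by-team : ∀ {T} → T ∈ teams n → (Θ* is T ∷ ψ ∷ []) ⊢ φ
    by-team {T} T∈ with T ⊨ᶠ? ψ | T ⊨ᶠ? φ
    ... | no T⊭ψ | _ =
      exfalso (⊭ᶠ⇒refutes T ψ (teams-unique T∈) sψ T⊭ψ (assum (here refl)) (assum (there (here refl))))
    ... | yes _ | yes T⊨φ = assum (here refl) ⟫ ⊨ᶠ⇒Θ*⊩ T φ sφ T⊨φ
    ... | yes T⊨ψ | no T⊭φ = contradiction (⊨⇒⊨ᶠ T φ sφ X img (ψ⊫φ X (⊨ᶠ⇒⊨ T ψ sψ T⊨ψ X img))) T⊭φ
      where
      X : Team
      X s = restrict is s ∈ T
      img : Image X T
      img = preimage-Image T

completeness : ∀ φ ψ → ψ ⊫ φ → ψ ⊩ φ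
completeness φ ψ = RowSemantics.⊫⇒⊩ is is-unique φ ψ (scoped φ ∈-++⁺ˡ) (scoped ψ (∈-++⁺ʳ (vars φ)))
  where
  indices : List ℕ
  indices = deduplicate _≟_ (vars φ ++ vars ψ)
  is : Vec ℕ _
  is = Vec.fromList indices
  toList-is : toList is ≡ indices
  toList-is = Vec.toList∘fromList indices
  is-unique : Unique (toList is)
  is-unique = subst Unique (sym toList-is) (deduplicate-! _≟_ (vars φ ++ vars ψ))
  scoped : ∀ χ → vars χ ⊆ vars φ ++ vars ψ → VarsIn (toList is) χ
  scoped χ vars⊆ = vars⊆⇒VarsIn χ (subst (_ ∈_) (sym toList-is) ∘ ∈-deduplicate⁺ _≟_ ∘ vars⊆)

theorem5p6 : (∀ (φ ψ : Form) → ψ ⊫ φ → (ψ ∷ []) ⊢ φ)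
           × (∀ (φ : Form) → ⊫ φ → [] ⊢ φ)
theorem5p6 = completeness , valid⇒provable
  where
  valid⇒provable : ∀ φ → ⊫ φ → [] ⊢ φ
  valid⇒provable φ ⊫φ = cut (ax-em 0) (completeness φ (var 0 ⊗ nvar 0) (λ X _ → ⊫φ X))
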